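{- Let $G=(V,E)$ be a finite strongly connected directed graph (loops and multiple arcs allowed), let $s\in V$ be a source vertex and $T\subseteq V$ a nonempty set of target vertices such that every arc leaving a vertex of $T$ ends at $s$. Fix at every vertex $v$ a rotor mechanism, i.e. an ordering $e_v^1,\dots,e_v^{d(v)}$ of the arcs leaving $v$, extended periodically to all $i\in\mathbb{Z}$ with period $d(v)$, and let $v^i$ be the head of $e_v^i$. Let $x_0=s,x_1,x_2,\dots$ be the rotor walk from $s$, i.e. the infinite sequence in which, for every vertex $v$ and every $i\ge 1$, the $i$-th occurrence of $v$ is immediately followed by $v^i$. Let $t_1,t_2,\dots$ be the hitting sequence, i.e. the subsequence of $(x_k)$ consisting of the terms lying in $T$. Then the hitting sequence is periodic: there is $D\ge 1$ with $t_{n+D}=t_n$ for all $n\ge 1$.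
   Context: $d(v)$ denotes the out-degree of $v$. The hitting sequence is infinite. "Periodic" means periodic from the first term on (not merely eventually periodic). -}

module Defs where

open import Data.Nat using (ℕ; zero; suc; NonZero; _<_)
open import Data.Nat.DivMod using (_mod_)
open import Data.Fin using (Fin; _≟_)
open import Data.Fin.Subset using (Subset; _∈_)
open import Data.Fin.Subset.Properties using (_∈?_)
open import Data.Product using (Σ; _×_; ∃)
open import Relation.Nullary using (yes; no)
open import Relation.Binary.PropositionalEquality using (_≡_)

-- A finite directed multigraph with a rotor mechanism, on vertex set Fin n:
--   deg  : Fin n → ℕ                      d(v), the out-degree of v
--   head : (v : Fin n) → Fin (deg v) → Fin n
-- The arcs leaving v are e_v^1, …, e_v^{d(v)}, represented by the indices
-- 0, …, d(v)-1 of Fin (deg v) (e_v^i ↦ index i-1), and head v j is the head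
-- of the corresponding arc.

data Reach {n : ℕ} (deg : Fin n → ℕ) (head : (v : Fin n) → Fin (deg v) → Fin n)
           : Fin n → Fin n → Set where
  here : ∀ {v} → Reach deg head v v
  step : ∀ {v w} (i : Fin (deg v)) → Reach deg head (head v i) w → Reach deg head v w

StronglyConnected : {n : ℕ} (deg : Fin n → ℕ) (head : (v : Fin n) → Fin (deg v) → Fin n) → Set
StronglyConnected deg head = ∀ v w → Reach deg head v w

occ : {n : ℕ} → (ℕ → Fin n) → ℕ → Fin n → ℕ
occ x zero v = zero
occ x (suc k) v with x k ≟ v
... | yes _ = suc (occ x k v)
... | no _  = occ x k v

hits : {n : ℕ} → (ℕ → Fin n) → Subset n → ℕ → ℕ
hits x T zero = zero
hits x T (suc k) with x k ∈? T
... | yes _ = suc (hits x T k)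
... | no _  = hits x T k

-- x is the rotor walk from s: x 0 = s, and the i-th occurrence of v (i ≥ 1),
-- say x k = v with occ x k v = i-1 earlier occurrences, is followed by
-- v^i = head of e_v^i, i.e. the arc with index (i-1) mod d(v).
IsRotorWalk : {n : ℕ} (deg : Fin n → ℕ) (head : (v : Fin n) → Fin (deg v) → Fin n)
              (nz : ∀ v → NonZero (deg v)) (s : Fin n) (x : ℕ → Fin n) → Set
IsRotorWalk deg head nz s x =
  (x 0 ≡ s) ×
  (∀ k → x (suc k) ≡ head (x k) (_mod_ (occ x k (x k)) (deg (x k)) {{nz (x k)}}))

-- HitAt x T m k : the m-th term (m ≥ 1) of the hitting sequence is x k,
-- i.e. x k ∈ T and exactly m-1 earlier terms lie in T.
HitAt : {n : ℕ} → (ℕ → Fin n) → Subset n → ℕ → ℕ → Set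
HitAt x T m k = (x k ∈ T) × (suc (hits x T k) ≡ m)

-- Write o_j v = occ x j v for the number of visits to v before time j, and sent v a w for the
-- number of the first a departures from v that go to w.  Every visit after time 0 is an arrival,
-- so o_{j+1} w = [w = s] + Σ_v sent v (o_j v) w.  The position of the walk together with the
-- rotors takes finitely many values, so it recurs at times K < K′; then π = o_K′ − o_K is a
-- multiple of the degrees, the walk is periodic from K on, π is a stationary flow, and π is
-- positive everywhere by strong connectivity.  Periodicity from the first hit comes from a
-- least-fixed-point bound: if the walk is at s at time a, then until the D-th subsequent hit
-- (D = Σ_{t∈T} π t) no vertex v is visited more than o_a v + π v times; since this bound has
-- mass exactly D on T, every target t is hit exactly π t times.  So t occurs π t times more
-- among the first m + D hits than among the first m, which forces t_{m+D} = t_m.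

module Submission where

open import Defs
open import Data.Bool.Base using (if_then_else_)
open import Data.Nat.Base
  using (ℕ; zero; suc; _+_; _*_; _∸_; _%_; _/_; _≤_; _<_; _≥_; z≤n; s≤s; s≤s⁻¹;
         _≤′_; ≤′-refl; ≤′-step; NonZero; >-nonZero)
open import Data.Nat.Properties hiding (_≟_)
open import Data.Nat.DivMod using (_mod_; m≡m%n+[m/n]*n; %-remove-+ʳ; m<n⇒m%n≡m)
open import Data.Nat.Divisibility using (_∣_; divides; ∣⇒≤)
open import Data.Fin.Base using (Fin; zero; suc; toℕ; combine)
open import Data.Fin.Properties
  using (_≟_; combine-injectiveˡ; combine-injectiveʳ; pigeonhole; toℕ-injective; toℕ-fromℕ<;
         fromℕ<-cong; toℕ<n)
open import Data.Fin.Subset using (Subset; _∈_; _∉_; Nonempty)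
open import Data.Fin.Subset.Properties using (_∈?_)
open import Data.Product using (Σ; ∃; ∃₂; _×_; _,_; proj₁; proj₂)
open import Data.Sum using (inj₁; inj₂)
open import Function.Base using (_∘_)
open import Relation.Nullary using (Dec; yes; no; does; ¬?; contradiction)
open import Relation.Binary.PropositionalEquality
open import Algebra.Properties.Semiring.Sum +-*-semiring
  using (sum; sum-syntax; sum-cong-≗; sum-replicate-zero; ∑-distrib-+; *-distribˡ-sum)
open import Algebra.Properties.CommutativeSemigroup +-commutativeSemigroup using (xy∙z≈xz∙y)

𝟙 : {P : Set} → Dec P → ℕ
𝟙 d = if does d then 1 else 0

module _ {P : Set} where

  𝟙-yes : (d : Dec P) → P → 𝟙 d ≡ 1
  𝟙-yes (yes _) _ = refl
  𝟙-yes (no ¬p) p = contradiction p ¬p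

  𝟙≡1⇒ : (d : Dec P) → 𝟙 d ≡ 1 → P
  𝟙≡1⇒ (yes p) _  = p
  𝟙≡1⇒ (no _)  ()

  𝟙-yes-* : (d : Dec P) → P → ∀ m → 𝟙 d * m ≡ m
  𝟙-yes-* d p m = trans (cong (_* m) (𝟙-yes d p)) (*-identityˡ m)

  𝟙-yes-*-cancel : (d : Dec P) → P → ∀ {m n} → 𝟙 d * m ≡ 𝟙 d * n → m ≡ n
  𝟙-yes-*-cancel d p {m} {n} eq = trans (sym (𝟙-yes-* d p m)) (trans eq (𝟙-yes-* d p n))

  𝟙+𝟙¬≡1 : (d : Dec P) → 𝟙 d + 𝟙 (¬? d) ≡ 1
  𝟙+𝟙¬≡1 (yes _) = refl
  𝟙+𝟙¬≡1 (no _)  = refl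

sum-mono-≤ : ∀ {n} {f g : Fin n → ℕ} → (∀ i → f i ≤ g i) → sum f ≤ sum g
sum-mono-≤ {zero}  _   = z≤n
sum-mono-≤ {suc n} f≤g = +-mono-≤ (f≤g zero) (sum-mono-≤ (f≤g ∘ suc))

≤-sum : ∀ {n} (f : Fin n → ℕ) i → f i ≤ sum f
≤-sum f zero    = m≤m+n _ _
≤-sum f (suc i) = ≤-trans (≤-sum (f ∘ suc) i) (m≤n+m _ _)

sum-≤-≡⇒≗ : ∀ {n} {f g : Fin n → ℕ} → (∀ i → f i ≤ g i) → sum f ≡ sum g → ∀ i → f i ≡ g i
sum-≤-≡⇒≗ {suc n} {f} {g} f≤g eq zero    = head≡
  where
  head≡ : f zero ≡ g zero
  head≡ = ≤-antisym (f≤g zero) (+-cancelʳ-≤ (sum (g ∘ suc)) (g zero) (f zero)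
            (subst (_≤ f zero + sum (g ∘ suc)) eq (+-monoʳ-≤ (f zero) (sum-mono-≤ (f≤g ∘ suc)))))
sum-≤-≡⇒≗ {suc n} {f} {g} f≤g eq (suc i) = sum-≤-≡⇒≗ (f≤g ∘ suc) tail≡ i
  where
  tail≡ : sum (f ∘ suc) ≡ sum (g ∘ suc)
  tail≡ = +-cancelˡ-≡ (f zero) _ _ (trans eq (cong (_+ sum (g ∘ suc)) (sym (sum-≤-≡⇒≗ f≤g eq zero))))

sum-δ : ∀ {n} (u : Fin n) (g : Fin n → ℕ) → ∑[ v < n ] (𝟙 (u ≟ v) * g v) ≡ g u
sum-δ {suc n} zero    g = trans (cong₂ _+_ (+-identityʳ (g zero)) (sum-replicate-zero n)) (+-identityʳ (g zero))
sum-δ         (suc u) g = sum-δ u (g ∘ suc)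

sum-split : ∀ {n} {P : Fin n → Set} (P? : ∀ v → Dec (P v)) (f : Fin n → ℕ) →
            sum f ≡ ∑[ v < n ] (𝟙 (P? v) * f v) + ∑[ v < n ] (𝟙 (¬? (P? v)) * f v)
sum-split P? f = trans (sum-cong-≗ split-term) (∑-distrib-+ (λ v → 𝟙 (P? v) * f v) (λ v → 𝟙 (¬? (P? v)) * f v))
  where
  split-term : ∀ v → f v ≡ 𝟙 (P? v) * f v + 𝟙 (¬? (P? v)) * f v
  split-term v = begin
    f v                                       ≡⟨ sym (*-identityˡ (f v)) ⟩
    1 * f v                                   ≡⟨ cong (_* f v) (sym (𝟙+𝟙¬≡1 (P? v))) ⟩
    (𝟙 (P? v) + 𝟙 (¬? (P? v))) * f v          ≡⟨ *-distribʳ-+ (f v) (𝟙 (P? v)) (𝟙 (¬? (P? v))) ⟩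
    𝟙 (P? v) * f v + 𝟙 (¬? (P? v)) * f v      ∎
    where open ≡-Reasoning

∑⟨_⟩_ : ∀ {n} → Subset n → (Fin n → ℕ) → ℕ
∑⟨_⟩_ {n} T f = ∑[ v < n ] (𝟙 (v ∈? T) * f v)

∑⟨⟩-+ : ∀ {n} (T : Subset n) (f g : Fin n → ℕ) → ∑⟨ T ⟩ (λ v → f v + g v) ≡ ∑⟨ T ⟩ f + ∑⟨ T ⟩ g
∑⟨⟩-+ T f g = trans (sum-cong-≗ (λ v → *-distribˡ-+ (𝟙 (v ∈? T)) (f v) (g v)))
                 (∑-distrib-+ (λ v → 𝟙 (v ∈? T) * f v) (λ v → 𝟙 (v ∈? T) * g v))

mono-≤-from-suc : (f : ℕ → ℕ) → (∀ a → f a ≤ f (suc a)) → ∀ {a b} → a ≤ b → f a ≤ f b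
mono-≤-from-suc f f≤f∘suc a≤b = go (≤⇒≤′ a≤b)
  where
  go : ∀ {a b} → a ≤′ b → f a ≤ f b
  go ≤′-refl        = ≤-refl
  go (≤′-step a≤′b) = ≤-trans (go a≤′b) (f≤f∘suc _)

%-≡⇒∣∸ : ∀ d .{{_ : NonZero d}} {m n} → m % d ≡ n % d → d ∣ n ∸ m
%-≡⇒∣∸ d {m} {n} eq = divides (n / d ∸ m / d) (begin
  n ∸ m                                      ≡⟨ cong₂ _∸_ (m≡m%n+[m/n]*n n d) (m≡m%n+[m/n]*n m d) ⟩
  (n % d + n / d * d) ∸ (m % d + m / d * d)  ≡⟨ cong (λ r → (n % d + n / d * d) ∸ (r + m / d * d)) eq ⟩
  (n % d + n / d * d) ∸ (n % d + m / d * d)  ≡⟨ [m+n]∸[m+o]≡n∸o (n % d) _ _ ⟩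
  n / d * d ∸ m / d * d                      ≡⟨ sym (*-distribʳ-∸ d (n / d) (m / d)) ⟩
  (n / d ∸ m / d) * d                        ∎)
  where open ≡-Reasoning

mod-≡⇒%-≡ : ∀ {d} .{{_ : NonZero d}} m n → m mod d ≡ n mod d → m % d ≡ n % d
mod-≡⇒%-≡ m n eq = trans (sym (toℕ-fromℕ< _)) (trans (cong toℕ eq) (toℕ-fromℕ< _))

∏ : ∀ {n} → (Fin n → ℕ) → ℕ
∏ {zero}  d = 1
∏ {suc n} d = d zero * ∏ (d ∘ suc)

encodeΠ : ∀ {n} (d : Fin n → ℕ) → ((v : Fin n) → Fin (d v)) → Fin (∏ d)
encodeΠ {zero}  d r = zero
encodeΠ {suc n} d r = combine (r zero) (encodeΠ (d ∘ suc) (r ∘ suc))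

encodeΠ-injective : ∀ {n} (d : Fin n → ℕ) {r r′ : (v : Fin n) → Fin (d v)} →
                    encodeΠ d r ≡ encodeΠ d r′ → ∀ v → r v ≡ r′ v
encodeΠ-injective d {r} {r′} eq zero    = combine-injectiveˡ (r zero) _ (r′ zero) _ eq
encodeΠ-injective d {r} {r′} eq (suc v) =
  encodeΠ-injective (d ∘ suc) (combine-injectiveʳ (r zero) _ (r′ zero) _ eq) v

module RotorMechanism {n : ℕ} (deg : Fin n → ℕ) (head : (v : Fin n) → Fin (deg v) → Fin n)
                      (nz : ∀ v → NonZero (deg v)) where

  instance
    deg-nonZero : ∀ {v} → NonZero (deg v)
    deg-nonZero {v} = nz v

  -- next v a is v^(a+1) of the paper: departures from v are counted from 0.
  next : Fin n → ℕ → Fin n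
  next v a = head v (a mod deg v)

  sent : Fin n → ℕ → Fin n → ℕ
  sent v zero    w = 0
  sent v (suc a) w = sent v a w + 𝟙 (next v a ≟ w)

  sent-mono : ∀ v w {a b} → a ≤ b → sent v a w ≤ sent v b w
  sent-mono v w = mono-≤-from-suc (λ a → sent v a w) (λ a → m≤m+n _ _)

  sent-+𝟙 : ∀ v w a {P : Set} (d : Dec P) → sent v (a + 𝟙 d) w ≡ sent v a w + 𝟙 d * 𝟙 (next v a ≟ w)
  sent-+𝟙 v w a (yes _) rewrite +-comm a 1 = cong (sent v a w +_) (sym (+-identityʳ _))
  sent-+𝟙 v w a (no _)  rewrite +-identityʳ a = sym (+-identityʳ _)

  next-periodic : ∀ v a {p} → deg v ∣ p → next v (a + p) ≡ next v a
  next-periodic v a d∣p = cong (head v) (fromℕ<-cong _ _ (%-remove-+ʳ a d∣p) _ _)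

  sent-+-multiple : ∀ v w {p} → deg v ∣ p → ∀ a → sent v (a + p) w ≡ sent v a w + sent v p w
  sent-+-multiple v w d∣p zero    = refl
  sent-+-multiple v w {p} d∣p (suc a) = begin
    sent v (a + p) w + 𝟙 (next v (a + p) ≟ w)
      ≡⟨ cong₂ (λ m u → m + 𝟙 (u ≟ w)) (sent-+-multiple v w d∣p a) (next-periodic v a d∣p) ⟩
    sent v a w + sent v p w + 𝟙 (next v a ≟ w)  ≡⟨ xy∙z≈xz∙y (sent v a w) _ _ ⟩
    sent v a w + 𝟙 (next v a ≟ w) + sent v p w  ∎
    where open ≡-Reasoning

  sent-all-arcs : ∀ v {a} → deg v ≤ a → ∀ i → 1 ≤ sent v a (head v i)
  sent-all-arcs v {a} deg≤a i = begin
    1                                        ≡⟨ sym (𝟙-yes (next v (toℕ i) ≟ head v i) next-i) ⟩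
    𝟙 (next v (toℕ i) ≟ head v i)            ≤⟨ m≤n+m _ _ ⟩
    sent v (suc (toℕ i)) (head v i)          ≤⟨ sent-mono v (head v i) (≤-trans (toℕ<n i) deg≤a) ⟩
    sent v a (head v i)                      ∎
    where
    open ≤-Reasoning
    next-i : next v (toℕ i) ≡ head v i
    next-i = cong (head v) (toℕ-injective (trans (toℕ-fromℕ< _) (m<n⇒m%n≡m (toℕ<n i))))

  sent-constant : ∀ {v u} → (∀ i → head v i ≡ u) → ∀ a w → sent v a w ≡ a * 𝟙 (u ≟ w)
  sent-constant const zero    w = refl
  sent-constant {v} {u} const (suc a) w = begin
    sent v a w + 𝟙 (next v a ≟ w)  ≡⟨ cong₂ (λ m z → m + 𝟙 (z ≟ w)) (sent-constant const a w) (const _) ⟩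
    a * 𝟙 (u ≟ w) + 𝟙 (u ≟ w)      ≡⟨ +-comm (a * 𝟙 (u ≟ w)) _ ⟩
    suc a * 𝟙 (u ≟ w)              ∎
    where open ≡-Reasoning

module Visits {n : ℕ} (x : ℕ → Fin n) where

  occ-suc : ∀ j v → occ x (suc j) v ≡ occ x j v + 𝟙 (x j ≟ v)
  occ-suc j v with x j ≟ v
  ... | yes _ = +-comm 1 (occ x j v)
  ... | no _  = sym (+-identityʳ (occ x j v))

  hits-suc : ∀ T j → hits x T (suc j) ≡ hits x T j + 𝟙 (x j ∈? T)
  hits-suc T j with x j ∈? T
  ... | yes _ = +-comm 1 (hits x T j)
  ... | no _  = sym (+-identityʳ (hits x T j))

  occ-mono : ∀ v {a b} → a ≤ b → occ x a v ≤ occ x b v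
  occ-mono v = mono-≤-from-suc (λ j → occ x j v)
                               (λ j → subst (occ x j v ≤_) (sym (occ-suc j v)) (m≤m+n _ _))

  hits-∑occ : ∀ T j → hits x T j ≡ ∑⟨ T ⟩ occ x j
  hits-∑occ T zero    = sym (trans (sum-cong-≗ (λ v → *-zeroʳ (𝟙 (v ∈? T)))) (sum-replicate-zero n))
  hits-∑occ T (suc j) = begin
    hits x T (suc j)
      ≡⟨ hits-suc T j ⟩
    hits x T j + 𝟙 (x j ∈? T)
      ≡⟨ cong₂ _+_ (hits-∑occ T j) (sym (sum-δ (x j) (λ v → 𝟙 (v ∈? T)))) ⟩
    ∑⟨ T ⟩ occ x j + ∑[ v < n ] (𝟙 (x j ≟ v) * 𝟙 (v ∈? T))
      ≡⟨ cong (∑⟨ T ⟩ occ x j +_) (sum-cong-≗ (λ v → *-comm (𝟙 (x j ≟ v)) _)) ⟩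
    ∑⟨ T ⟩ occ x j + ∑⟨ T ⟩ (λ v → 𝟙 (x j ≟ v))
      ≡⟨ sym (∑⟨⟩-+ T (occ x j) _) ⟩
    ∑⟨ T ⟩ (λ v → occ x j v + 𝟙 (x j ≟ v))
      ≡⟨ sum-cong-≗ (λ v → cong (𝟙 (v ∈? T) *_) (sym (occ-suc j v))) ⟩
    ∑⟨ T ⟩ occ x (suc j)
      ∎
    where open ≡-Reasoning

  hits-mono : ∀ T {a b} → a ≤ b → hits x T a ≤ hits x T b
  hits-mono T {a} {b} a≤b = begin
    hits x T a      ≡⟨ hits-∑occ T a ⟩
    ∑⟨ T ⟩ occ x a  ≤⟨ sum-mono-≤ (λ v → *-monoʳ-≤ (𝟙 (v ∈? T)) (occ-mono v a≤b)) ⟩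
    ∑⟨ T ⟩ occ x b  ≡⟨ sym (hits-∑occ T b) ⟩
    hits x T b      ∎
    where open ≤-Reasoning

  hits-at-target : ∀ T {k} → x k ∈ T → hits x T (suc k) ≡ suc (hits x T k)
  hits-at-target T {k} x-k∈T =
    trans (hits-suc T k) (trans (cong (hits x T k +_) (𝟙-yes (x k ∈? T) x-k∈T)) (+-comm _ 1))

  occ-target-stable : ∀ T {a b} → a ≤ b → hits x T a ≡ hits x T b → ∀ {t} → t ∈ T → occ x a t ≡ occ x b t
  occ-target-stable T {a} {b} a≤b eq {t} t∈T =
    𝟙-yes-*-cancel (t ∈? T) t∈T (sum-≤-≡⇒≗ (λ v → *-monoʳ-≤ (𝟙 (v ∈? T)) (occ-mono v a≤b)) ∑⟨T⟩≡ t)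
    where
    ∑⟨T⟩≡ : ∑⟨ T ⟩ occ x a ≡ ∑⟨ T ⟩ occ x b
    ∑⟨T⟩≡ = trans (sym (hits-∑occ T a)) (trans eq (hits-∑occ T b))

  occ-target-determined : ∀ T a b → hits x T a ≡ hits x T b → ∀ {t} → t ∈ T → occ x a t ≡ occ x b t
  occ-target-determined T a b eq t∈T with ≤-total a b
  ... | inj₁ a≤b = occ-target-stable T a≤b eq t∈T
  ... | inj₂ b≤a = sym (occ-target-stable T b≤a (sym eq) t∈T)

  nth-hit-before : ∀ T m j → suc m ≤ hits x T j → ∃ λ k → HitAt x T (suc m) k
  nth-hit-before T m zero    ()
  nth-hit-before T m (suc j) m<hits with suc m ≤? hits x T j
  ... | yes m<hits-j = nth-hit-before T m j m<hits-j
  ... | no m≮hits-j with x j ∈? T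
  ...   | yes x-j∈T = j , x-j∈T , cong suc (≤-antisym (s≤s⁻¹ (≰⇒> m≮hits-j)) (s≤s⁻¹ m<hits))
  ...   | no _      = contradiction m<hits m≮hits-j

module RotorWalk {n : ℕ} (deg : Fin n → ℕ) (head : (v : Fin n) → Fin (deg v) → Fin n)
                 (nz : ∀ v → NonZero (deg v)) (s : Fin n) (x : ℕ → Fin n)
                 (walk : IsRotorWalk deg head nz s x) where

  open RotorMechanism deg head nz
  open Visits x

  x-suc : ∀ k → x (suc k) ≡ next (x k) (occ x k (x k))
  x-suc = proj₂ walk

  inflow : ℕ → Fin n → ℕ
  inflow j w = ∑[ v < n ] sent v (occ x j v) w

  inflow-suc : ∀ j w → inflow (suc j) w ≡ inflow j w + 𝟙 (x (suc j) ≟ w)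
  inflow-suc j w = begin
    ∑[ v < n ] sent v (occ x (suc j) v) w
      ≡⟨ sum-cong-≗ departure ⟩
    ∑[ v < n ] (sent v (occ x j v) w + 𝟙 (x j ≟ v) * arrival v)
      ≡⟨ ∑-distrib-+ (λ v → sent v (occ x j v) w) (λ v → 𝟙 (x j ≟ v) * arrival v) ⟩
    inflow j w + ∑[ v < n ] (𝟙 (x j ≟ v) * arrival v)
      ≡⟨ cong (inflow j w +_) (sum-δ (x j) arrival) ⟩
    inflow j w + arrival (x j)
      ≡⟨ cong (λ u → inflow j w + 𝟙 (u ≟ w)) (sym (x-suc j)) ⟩
    inflow j w + 𝟙 (x (suc j) ≟ w)
      ∎
    where
    open ≡-Reasoning
    arrival : Fin n → ℕ
    arrival v = 𝟙 (next v (occ x j v) ≟ w)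
    departure : ∀ v → sent v (occ x (suc j) v) w ≡ sent v (occ x j v) w + 𝟙 (x j ≟ v) * arrival v
    departure v = trans (cong (λ a → sent v a w) (occ-suc j v)) (sent-+𝟙 v w (occ x j v) (x j ≟ v))

  flow : ∀ j w → occ x (suc j) w ≡ 𝟙 (s ≟ w) + inflow j w
  flow zero w = begin
    occ x 1 w                 ≡⟨ occ-suc 0 w ⟩
    𝟙 (x 0 ≟ w)               ≡⟨ cong (λ u → 𝟙 (u ≟ w)) (proj₁ walk) ⟩
    𝟙 (s ≟ w)                 ≡⟨ sym (+-identityʳ _) ⟩
    𝟙 (s ≟ w) + 0             ≡⟨ cong (𝟙 (s ≟ w) +_) (sym (sum-replicate-zero n)) ⟩
    𝟙 (s ≟ w) + inflow 0 w    ∎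
    where open ≡-Reasoning
  flow (suc j) w = begin
    occ x (suc (suc j)) w                            ≡⟨ occ-suc (suc j) w ⟩
    occ x (suc j) w + 𝟙 (x (suc j) ≟ w)              ≡⟨ cong (_+ 𝟙 (x (suc j) ≟ w)) (flow j w) ⟩
    𝟙 (s ≟ w) + inflow j w + 𝟙 (x (suc j) ≟ w)       ≡⟨ +-assoc (𝟙 (s ≟ w)) _ _ ⟩
    𝟙 (s ≟ w) + (inflow j w + 𝟙 (x (suc j) ≟ w))     ≡⟨ cong (𝟙 (s ≟ w) +_) (sym (inflow-suc j w)) ⟩
    𝟙 (s ≟ w) + inflow (suc j) w                     ∎
    where open ≡-Reasoning

  occ-at-source : ∀ {a} → x a ≡ s → ∀ w → occ x a w ≡ inflow a w
  occ-at-source {a} x-a≡s w = +-cancelʳ-≡ (𝟙 (s ≟ w)) _ _ (begin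
    occ x a w + 𝟙 (s ≟ w)    ≡⟨ cong (λ u → occ x a w + 𝟙 (u ≟ w)) (sym x-a≡s) ⟩
    occ x a w + 𝟙 (x a ≟ w)  ≡⟨ sym (occ-suc a w) ⟩
    occ x (suc a) w          ≡⟨ flow a w ⟩
    𝟙 (s ≟ w) + inflow a w   ≡⟨ +-comm (𝟙 (s ≟ w)) _ ⟩
    inflow a w + 𝟙 (s ≟ w)   ∎)
    where open ≡-Reasoning

  -- The position of the walk at time k together with the current rotor of every vertex.
  state : ℕ → Fin (n * ∏ deg)
  state k = combine (x k) (encodeΠ deg (λ v → occ x k v mod deg v))

  recurrent-state : ∃₂ λ K K′ → K < K′ × x K ≡ x K′ × (∀ v → deg v ∣ occ x K′ v ∸ occ x K v)
  recurrent-state with pigeonhole (n<1+n (n * ∏ deg)) (state ∘ toℕ)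
  ... | i , j , i<j , eq =
    toℕ i , toℕ j , i<j , combine-injectiveˡ (x (toℕ i)) _ (x (toℕ j)) _ eq , rotors-agree
    where
    rotors-equal : ∀ v → occ x (toℕ i) v mod deg v ≡ occ x (toℕ j) v mod deg v
    rotors-equal = encodeΠ-injective deg (combine-injectiveʳ (x (toℕ i)) _ (x (toℕ j)) _ eq)
    rotors-agree : ∀ v → deg v ∣ occ x (toℕ j) v ∸ occ x (toℕ i) v
    rotors-agree v = %-≡⇒∣∸ (deg v) (mod-≡⇒%-≡ (occ x (toℕ i) v) (occ x (toℕ j) v) (rotors-equal v))

  module Recurrence (K K′ : ℕ) (K<K′ : K < K′) (x-K≡x-K′ : x K ≡ x K′)
                    (deg∣π : ∀ v → deg v ∣ occ x K′ v ∸ occ x K v) where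

    π : Fin n → ℕ
    π v = occ x K′ v ∸ occ x K v

    occ-K′ : ∀ v → occ x K′ v ≡ occ x K v + π v
    occ-K′ v = sym (m+[n∸m]≡n (occ-mono v (<⇒≤ K<K′)))

    walk-periodic : ∀ d → x (d + K′) ≡ x (d + K) × (∀ v → occ x (d + K′) v ≡ occ x (d + K) v + π v)
    walk-periodic zero    = sym x-K≡x-K′ , occ-K′
    walk-periodic (suc d) = trans (x-suc (d + K′)) (trans next≡ (sym (x-suc (d + K)))) , occ≡
      where
      open ≡-Reasoning
      u : Fin n
      u = x (d + K)
      x≡ : x (d + K′) ≡ u
      x≡ = proj₁ (walk-periodic d)
      occ-d≡ : ∀ v → occ x (d + K′) v ≡ occ x (d + K) v + π v
      occ-d≡ = proj₂ (walk-periodic d)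
      next≡ : next (x (d + K′)) (occ x (d + K′) (x (d + K′))) ≡ next u (occ x (d + K) u)
      next≡ = begin
        next (x (d + K′)) (occ x (d + K′) (x (d + K′)))  ≡⟨ cong (λ z → next z (occ x (d + K′) z)) x≡ ⟩
        next u (occ x (d + K′) u)                        ≡⟨ cong (next u) (occ-d≡ u) ⟩
        next u (occ x (d + K) u + π u)                   ≡⟨ next-periodic u _ (deg∣π u) ⟩
        next u (occ x (d + K) u)                         ∎
      occ≡ : ∀ v → occ x (suc d + K′) v ≡ occ x (suc d + K) v + π v
      occ≡ v = begin
        occ x (suc (d + K′)) v                          ≡⟨ occ-suc (d + K′) v ⟩
        occ x (d + K′) v + 𝟙 (x (d + K′) ≟ v)           ≡⟨ cong₂ (λ o z → o + 𝟙 (z ≟ v)) (occ-d≡ v) x≡ ⟩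
        occ x (d + K) v + π v + 𝟙 (u ≟ v)               ≡⟨ xy∙z≈xz∙y (occ x (d + K) v) _ _ ⟩
        occ x (d + K) v + 𝟙 (u ≟ v) + π v               ≡⟨ cong (_+ π v) (sym (occ-suc (d + K) v)) ⟩
        occ x (suc (d + K)) v + π v                     ∎

    inflow-+π : ∀ (f : Fin n → ℕ) w →
                ∑[ v < n ] sent v (f v + π v) w ≡ ∑[ v < n ] sent v (f v) w + ∑[ v < n ] sent v (π v) w
    inflow-+π f w = trans (sum-cong-≗ (λ v → sent-+-multiple v w (deg∣π v) (f v)))
                          (∑-distrib-+ (λ v → sent v (f v) w) (λ v → sent v (π v) w))

    π-stationary : ∀ w → π w ≡ ∑[ v < n ] sent v (π v) w
    π-stationary w = +-cancelˡ-≡ (occ x (suc K) w) _ _ (begin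
      occ x (suc K) w + π w              ≡⟨ sym (proj₂ (walk-periodic 1) w) ⟩
      occ x (suc K′) w                   ≡⟨ flow K′ w ⟩
      𝟙 (s ≟ w) + inflow K′ w            ≡⟨ cong (𝟙 (s ≟ w) +_) inflow-K′ ⟩
      𝟙 (s ≟ w) + (inflow K w + Σπ)      ≡⟨ sym (+-assoc (𝟙 (s ≟ w)) _ _) ⟩
      𝟙 (s ≟ w) + inflow K w + Σπ        ≡⟨ cong (_+ Σπ) (sym (flow K w)) ⟩
      occ x (suc K) w + Σπ               ∎)
      where
      open ≡-Reasoning
      Σπ : ℕ
      Σπ = ∑[ v < n ] sent v (π v) w
      inflow-K′ : inflow K′ w ≡ inflow K w + Σπ
      inflow-K′ = trans (sum-cong-≗ (λ v → cong (λ a → sent v a w) (occ-K′ v))) (inflow-+π (occ x K) w)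

    π-x-K-positive : 1 ≤ π (x K)
    π-x-K-positive = +-cancelˡ-≤ (occ x K (x K)) 1 (π (x K)) (begin
      occ x K (x K) + 1               ≡⟨ cong (occ x K (x K) +_) (sym (𝟙-yes (x K ≟ x K) refl)) ⟩
      occ x K (x K) + 𝟙 (x K ≟ x K)   ≡⟨ sym (occ-suc K (x K)) ⟩
      occ x (suc K) (x K)             ≤⟨ occ-mono (x K) K<K′ ⟩
      occ x K′ (x K)                  ≡⟨ occ-K′ (x K) ⟩
      occ x K (x K) + π (x K)         ∎)
      where open ≤-Reasoning

    -- π v ≥ 1 forces π v ≥ deg v, so every arc out of v carries flow.
    π-positive-step : ∀ v i → 1 ≤ π v → 1 ≤ π (head v i)
    π-positive-step v i 1≤πv = begin
      1                                        ≤⟨ sent-all-arcs v (∣⇒≤ {{>-nonZero 1≤πv}} (deg∣π v)) i ⟩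
      sent v (π v) (head v i)                  ≤⟨ ≤-sum (λ u → sent u (π u) (head v i)) v ⟩
      ∑[ u < n ] sent u (π u) (head v i)       ≡⟨ sym (π-stationary (head v i)) ⟩
      π (head v i)                             ∎
      where open ≤-Reasoning

    π-positive-along : ∀ {v w} → Reach deg head v w → 1 ≤ π v → 1 ≤ π w
    π-positive-along here           1≤πv = 1≤πv
    π-positive-along (step i v⇝w)   1≤πv = π-positive-along v⇝w (π-positive-step _ i 1≤πv)

    module Targets (T : Subset n) (T→s : ∀ t → t ∈ T → ∀ i → head t i ≡ s)
                   (sc : StronglyConnected deg head) (nonempty : Nonempty T) where

      D : ℕ
      D = ∑⟨ T ⟩ π

      D-positive : D ≥ 1
      D-positive = begin
        1                           ≤⟨ π-positive-along (sc (x K) t₀) π-x-K-positive ⟩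
        π t₀                        ≡⟨ sym (𝟙-yes-* (t₀ ∈? T) t₀∈T (π t₀)) ⟩
        𝟙 (t₀ ∈? T) * π t₀          ≤⟨ ≤-sum (λ v → 𝟙 (v ∈? T) * π v) t₀ ⟩
        D                           ∎
        where
        open ≤-Reasoning
        t₀ : Fin n
        t₀ = proj₁ nonempty
        t₀∈T : t₀ ∈ T
        t₀∈T = proj₂ nonempty

      hits-periodic : ∀ d → hits x T (d + K′) ≡ hits x T (d + K) + D
      hits-periodic d = begin
        hits x T (d + K′)                      ≡⟨ hits-∑occ T (d + K′) ⟩
        ∑⟨ T ⟩ occ x (d + K′)
          ≡⟨ sum-cong-≗ (λ v → cong (𝟙 (v ∈? T) *_) (proj₂ (walk-periodic d) v)) ⟩
        ∑⟨ T ⟩ (λ v → occ x (d + K) v + π v)   ≡⟨ ∑⟨⟩-+ T (occ x (d + K)) π ⟩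
        ∑⟨ T ⟩ occ x (d + K) + D               ≡⟨ cong (_+ D) (sym (hits-∑occ T (d + K))) ⟩
        hits x T (d + K) + D                   ∎
        where open ≡-Reasoning

      hits-unbounded : ∀ m → ∃ λ d → m ≤ hits x T (d + K)
      hits-unbounded zero    = 0 , z≤n
      hits-unbounded (suc m) = d + (K′ ∸ K) , subst (λ j → suc m ≤ hits x T j) (sym d+L+K≡d+K′) (begin
        suc m                    ≡⟨ +-comm 1 m ⟩
        m + 1                    ≤⟨ +-mono-≤ m≤hits D-positive ⟩
        hits x T (d + K) + D     ≡⟨ sym (hits-periodic d) ⟩
        hits x T (d + K′)        ∎)
        where
        open ≤-Reasoning
        d : ℕ
        d = proj₁ (hits-unbounded m)
        m≤hits : m ≤ hits x T (d + K)
        m≤hits = proj₂ (hits-unbounded m)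
        d+L+K≡d+K′ : d + (K′ ∸ K) + K ≡ d + K′
        d+L+K≡d+K′ = trans (+-assoc d _ K) (cong (d +_) (m∸n+n≡m (<⇒≤ K<K′)))

      nth-hit : ∀ m → m ≥ 1 → ∃ λ k → HitAt x T m k
      nth-hit (suc m) _ =
        nth-hit-before T m (proj₁ (hits-unbounded (suc m)) + K) (proj₂ (hits-unbounded (suc m)))

      after-target : ∀ {k} → x k ∈ T → x (suc k) ≡ s
      after-target {k} x-k∈T = trans (x-suc k) (T→s (x k) x-k∈T _)

      at-source-after-hits : ∀ c → ∃ λ a → x a ≡ s × hits x T a ≡ c
      at-source-after-hits zero    = 0 , proj₁ walk , refl
      at-source-after-hits (suc c) with nth-hit (suc c) (s≤s z≤n)
      ... | k , x-k∈T , hits-k = suc k , after-target x-k∈T , trans (hits-at-target T x-k∈T) hits-k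

      inflowᴺ : (Fin n → ℕ) → Fin n → ℕ
      inflowᴺ f w = ∑[ v < n ] (𝟙 (¬? (v ∈? T)) * sent v (f v) w)

      inflow-split : ∀ f w → ∑[ v < n ] sent v (f v) w ≡ 𝟙 (s ≟ w) * ∑⟨ T ⟩ f + inflowᴺ f w
      inflow-split f w = trans (sum-split (_∈? T) (λ v → sent v (f v) w))
        (cong (_+ inflowᴺ f w)
              (trans (sum-cong-≗ from-target) (sym (*-distribˡ-sum (𝟙 (s ≟ w)) (λ v → 𝟙 (v ∈? T) * f v)))))
        where
        from-target : ∀ v → 𝟙 (v ∈? T) * sent v (f v) w ≡ 𝟙 (s ≟ w) * (𝟙 (v ∈? T) * f v)
        from-target v with v ∈? T
        ... | yes v∈T = begin
          sent v (f v) w + 0        ≡⟨ +-identityʳ _ ⟩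
          sent v (f v) w            ≡⟨ sent-constant (T→s v v∈T) (f v) w ⟩
          f v * 𝟙 (s ≟ w)           ≡⟨ *-comm (f v) _ ⟩
          𝟙 (s ≟ w) * f v           ≡⟨ cong (𝟙 (s ≟ w) *_) (sym (+-identityʳ (f v))) ⟩
          𝟙 (s ≟ w) * (f v + 0)     ∎
          where open ≡-Reasoning
        ... | no _    = sym (*-zeroʳ (𝟙 (s ≟ w)))

      inflowᴺ-mono : ∀ f g → (∀ v → v ∉ T → f v ≤ g v) → ∀ w → inflowᴺ f w ≤ inflowᴺ g w
      inflowᴺ-mono f g f≤g w = sum-mono-≤ term≤
        where
        term≤ : ∀ v → 𝟙 (¬? (v ∈? T)) * sent v (f v) w ≤ 𝟙 (¬? (v ∈? T)) * sent v (g v) w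
        term≤ v with v ∈? T
        ... | yes _  = z≤n
        ... | no v∉T = *-monoʳ-≤ 1 (sent-mono v w (f≤g v v∉T))

      module Excursion {a : ℕ} (x-a≡s : x a ≡ s) where

        Y : Fin n → ℕ
        Y v = occ x a v + π v

        M : ℕ
        M = hits x T a + D

        Y-stationary : ∀ w → Y w ≡ ∑[ v < n ] sent v (Y v) w
        Y-stationary w =
          trans (cong₂ _+_ (occ-at-source x-a≡s w) (π-stationary w)) (sym (inflow-+π (occ x a) w))

        ∑⟨T⟩Y : ∑⟨ T ⟩ Y ≡ M
        ∑⟨T⟩Y = trans (∑⟨⟩-+ T (occ x a) π) (cong (_+ D) (sym (hits-∑occ T a)))

        occ-suc≤Y : ∀ j → hits x T j < M → (∀ v → v ∉ T → occ x j v ≤ Y v) → ∀ w → occ x (suc j) w ≤ Y w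
        occ-suc≤Y j hits<M below w = begin
          occ x (suc j) w                                 ≡⟨ flow j w ⟩
          c + inflow j w                                  ≡⟨ cong (c +_) (inflow-split (occ x j) w) ⟩
          c + (c * ∑⟨ T ⟩ occ x j + inflowᴺ (occ x j) w)  ≡⟨ sym (+-assoc c _ _) ⟩
          c + c * ∑⟨ T ⟩ occ x j + inflowᴺ (occ x j) w    ≡⟨ cong (_+ inflowᴺ (occ x j) w) source-term ⟩
          c * suc (hits x T j) + inflowᴺ (occ x j) w      ≤⟨ +-mono-≤ (*-monoʳ-≤ c hits<M) (inflowᴺ-mono (occ x j) Y below w) ⟩
          c * M + inflowᴺ Y w                             ≡⟨ cong (λ h → c * h + inflowᴺ Y w) (sym ∑⟨T⟩Y) ⟩
          c * ∑⟨ T ⟩ Y + inflowᴺ Y w                      ≡⟨ sym (inflow-split Y w) ⟩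
          ∑[ v < n ] sent v (Y v) w                       ≡⟨ sym (Y-stationary w) ⟩
          Y w                                             ∎
          where
          open ≤-Reasoning
          c : ℕ
          c = 𝟙 (s ≟ w)
          source-term : c + c * ∑⟨ T ⟩ occ x j ≡ c * suc (hits x T j)
          source-term = trans (cong (λ h → c + c * h) (sym (hits-∑occ T j))) (sym (*-suc c (hits x T j)))

        occ≤Y : ∀ j → hits x T j < M → ∀ w → occ x (suc j) w ≤ Y w
        occ≤Y zero    hits<M = occ-suc≤Y zero hits<M (λ _ _ → z≤n)
        occ≤Y (suc j) hits<M =
          occ-suc≤Y (suc j) hits<M (λ v _ → occ≤Y j (≤-<-trans (hits-mono T (n≤1+n j)) hits<M) v)

        -- occ x (suc k) ≤ Y at the M-th hit k, and both have mass M on T.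
        occ-after-D-hits : ∀ b → hits x T b ≡ M → ∀ {t} → t ∈ T → occ x b t ≡ Y t
        occ-after-D-hits b hits-b {t} t∈T with nth-hit M (≤-trans D-positive (m≤n+m D _))
        ... | k , x-k∈T , hits-k =
          trans (occ-target-determined T b (suc k) (trans hits-b (sym hits-suc-k)) t∈T)
                (𝟙-yes-*-cancel (t ∈? T) t∈T (sum-≤-≡⇒≗ bounded ∑⟨T⟩≡ t))
          where
          hits-suc-k : hits x T (suc k) ≡ M
          hits-suc-k = trans (hits-at-target T x-k∈T) hits-k
          bounded : ∀ v → 𝟙 (v ∈? T) * occ x (suc k) v ≤ 𝟙 (v ∈? T) * Y v
          bounded v = *-monoʳ-≤ (𝟙 (v ∈? T)) (occ≤Y k (≤-reflexive hits-k) v)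
          ∑⟨T⟩≡ : ∑⟨ T ⟩ occ x (suc k) ≡ ∑⟨ T ⟩ Y
          ∑⟨T⟩≡ = trans (sym (hits-∑occ T (suc k))) (trans hits-suc-k (sym ∑⟨T⟩Y))

      hitting-sequence-periodic : ∀ m k k′ → m ≥ 1 → HitAt x T m k → HitAt x T (m + D) k′ → x k ≡ x k′
      hitting-sequence-periodic (suc m) k k′ _ (x-k∈T , hits-k) (x-k′∈T , hits-k′) with at-source-after-hits m
      ... | a , x-a≡s , hits-a = sym (𝟙≡1⇒ (x k′ ≟ x k) (+-cancelˡ-≡ (occ x a t + π t) _ 1 counted))
        where
        open ≡-Reasoning
        t : Fin n
        t = x k
        counted : occ x a t + π t + 𝟙 (x k′ ≟ t) ≡ occ x a t + π t + 1
        counted = begin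
          occ x a t + π t + 𝟙 (x k′ ≟ t)
            ≡⟨ cong (_+ 𝟙 (x k′ ≟ t)) (sym (Excursion.occ-after-D-hits x-a≡s k′ hits-k′≡ x-k∈T)) ⟩
          occ x k′ t + 𝟙 (x k′ ≟ t)
            ≡⟨ sym (occ-suc k′ t) ⟩
          occ x (suc k′) t
            ≡⟨ Excursion.occ-after-D-hits (after-target x-k∈T) (suc k′) hits-suc-k′≡ x-k∈T ⟩
          occ x (suc k) t + π t
            ≡⟨ cong (_+ π t) (occ-suc k t) ⟩
          occ x k t + 𝟙 (x k ≟ t) + π t
            ≡⟨ cong₂ (λ o i → o + i + π t) occ-k≡ (𝟙-yes (x k ≟ t) refl) ⟩
          occ x a t + 1 + π t
            ≡⟨ xy∙z≈xz∙y (occ x a t) 1 (π t) ⟩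
          occ x a t + π t + 1
            ∎
          where
          hits-k′≡ : hits x T k′ ≡ hits x T a + D
          hits-k′≡ = trans (suc-injective hits-k′) (cong (_+ D) (sym hits-a))
          hits-suc-k′≡ : hits x T (suc k′) ≡ hits x T (suc k) + D
          hits-suc-k′≡ = trans (hits-at-target T x-k′∈T)
                               (trans hits-k′ (cong (_+ D) (sym (trans (hits-at-target T x-k∈T) hits-k))))
          occ-k≡ : occ x k t ≡ occ x a t
          occ-k≡ = occ-target-determined T k a (trans (suc-injective hits-k) (sym hits-a)) x-k∈T

theorem1 : (n : ℕ) (deg : Fin n → ℕ) (head : (v : Fin n) → Fin (deg v) → Fin n)
    → (nz : ∀ v → NonZero (deg v))
    → StronglyConnected deg head
    → (s : Fin n) (T : Subset n)
    → Nonempty T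
    → (∀ v → v ∈ T → ∀ i → head v i ≡ s)
    → (x : ℕ → Fin n)
    → IsRotorWalk deg head nz s x
    → (∀ m → m ≥ 1 → ∃ λ k → HitAt x T m k)
    × (Σ ℕ λ D → (D ≥ 1) × (∀ m k k′ → m ≥ 1 → HitAt x T m k → HitAt x T (m + D) k′ → x k ≡ x k′))
theorem1 n deg head nz sc s T nonempty T→s x walk =
  let open RotorWalk deg head nz s x walk
      K , K′ , K<K′ , x-K≡x-K′ , deg∣π = recurrent-state
      open Recurrence K K′ K<K′ x-K≡x-K′ deg∣π
      open Targets T T→s sc nonempty
  in nth-hit , D , D-positive , hitting-sequence-periodic
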